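{- Let $D$ be any symmetric $k$-uniform distribution on $\{ -1,1\}^n$ such that $\sum_{i=1}^n D_i$ is supported on a set $S\subseteq\mathbb{Z}$. Then there is a symmetric $k$-uniform distribution $D'$ on $\{ -1,1\}^n$ such that $\sum_{i=1}^n D'_i$ is supported on a subset $S'\subseteq S$ of size at most $k+1$.
   Context: A distribution on $\{ -1,1\}^n$ is symmetric if it is invariant under permutations of the coordinates. It is $k$-uniform if $\mathbb{E}[\prod_{i\in T}D_i]=0$ for every $T\subseteq[n]$ with $0<|T|\le k$.
   Formalization: The distributions D and D' assign rational probabilities to the points of $\{ -1,1\}^n$. -}

module Defs where

open import Data.Bool using (Bool; true; false)
open import Data.Nat using (ℕ; zero; suc; _<_; _≤_)
open import Data.Integer as ℤ using (ℤ)
open import Data.Rational as ℚ using (ℚ; 0ℚ; 1ℚ)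
open import Data.Fin using (Fin)
open import Data.Fin.Subset using (Subset; ∣_∣)
open import Data.Fin.Permutation using (Permutation′; _⟨$⟩ʳ_)
open import Data.Vec using (Vec; []; _∷_; lookup; tabulate; zipWith; foldr′)
open import Data.List using (List; []; _∷_; _++_; map; length)
open import Data.List.Relation.Unary.All using (All)
open import Data.List.Membership.Propositional using (_∈_)
open import Data.Product using (_×_)
open import Relation.Binary.PropositionalEquality using (_≡_; _≢_)

-- A point of {-1,1}^n: true ↦ +1, false ↦ -1.
Cube : ℕ → Set
Cube n = Vec Bool n

allPoints : (n : ℕ) → List (Cube n)
allPoints zero = [] ∷ []
allPoints (suc n) = map (true ∷_) (allPoints n) ++ map (false ∷_) (allPoints n)

signℚ : Bool → ℚ
signℚ true = 1ℚ
signℚ false = ℚ.- 1ℚ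

signℤ : Bool → ℤ
signℤ true = ℤ.+ 1
signℤ false = ℤ.- (ℤ.+ 1)

sumℚ : List ℚ → ℚ
sumℚ [] = 0ℚ
sumℚ (q ∷ qs) = q ℚ.+ sumℚ qs

Distribution : ℕ → Set
Distribution n = Cube n → ℚ

IsDistribution : {n : ℕ} → Distribution n → Set
IsDistribution {n} D = (∀ x → 0ℚ ℚ.≤ D x) × (sumℚ (map D (allPoints n)) ≡ 1ℚ)

expect : {n : ℕ} → Distribution n → (Cube n → ℚ) → ℚ
expect {n} D f = sumℚ (map (λ x → D x ℚ.* f x) (allPoints n))

chi : {n : ℕ} → Subset n → Cube n → ℚ
chi T x = foldr′ ℚ._*_ 1ℚ (zipWith (λ t b → sel t b) T x)
  where
  sel : Bool → Bool → ℚ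
  sel true b = signℚ b
  sel false b = 1ℚ

permute : {n : ℕ} → Permutation′ n → Cube n → Cube n
permute π x = tabulate (λ i → lookup x (π ⟨$⟩ʳ i))

Symmetric : {n : ℕ} → Distribution n → Set
Symmetric {n} D = ∀ (π : Permutation′ n) (x : Cube n) → D (permute π x) ≡ D x

KUniform : {n : ℕ} → ℕ → Distribution n → Set
KUniform {n} k D = ∀ (T : Subset n) → 0 < ∣ T ∣ → ∣ T ∣ ≤ k → expect D (chi T) ≡ 0ℚ

coordSum : {n : ℕ} → Cube n → ℤ
coordSum x = foldr′ ℤ._+_ (ℤ.+ 0) (Data.Vec.map signℤ x)

SumSupportedOn : {n : ℕ} → Distribution n → (ℤ → Set) → Set
SumSupportedOn D S = ∀ x → D x ≢ 0ℚ → S (coordSum x)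

-- a finite set given by a list (size ≤ length)
ListSet : List ℤ → ℤ → Set
ListSet L z = z ∈ L

{-# OPTIONS --safe #-}

-- A Carathéodory-type reduction.  Let L be a set of levels containing every value of
-- ∑ᵢ xᵢ on the support of D; levels carrying no mass are simply dropped.  For a
-- symmetric signed weight g the correlation E_g[χ_T] depends only on |T|, since a
-- permutation of coordinates moves T to an initial segment.  Hence "D·(c ∘ ∑)
-- annihilates every χ_T with |T| ≤ k" is a system of k + 1 homogeneous linear
-- equations in the unknowns (c_v)_{v ∈ L}; the case T = ∅ says that D·(c ∘ ∑) has
-- total mass 0.  If |L| > k + 1 there is a solution c ≠ 0, so c ∘ ∑ is negative
-- somewhere on the support.  Moving D along D·(c ∘ ∑) as far as nonnegativity
-- allows gives a symmetric k-uniform distribution that vanishes on the level where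
-- c is minimal, so L loses an element; iterate until |L| ≤ k + 1.

module Submission where

open import Defs
open import Algebra.Bundles using (CommutativeMonoid)
import Algebra.Properties.CommutativeMonoid.Sum as FinSum
open import Data.Bool using (Bool; true; false; if_then_else_)
open import Data.Empty using (⊥; ⊥-elim)
import Data.Fin as Fin
open import Data.Fin.Permutation as Perm using (Permutation′; _⟨$⟩ʳ_)
open import Data.Fin.Subset as Subset using (Subset; ∣_∣)
import Data.Fin.Subset.Properties as Subset
open import Data.Integer as ℤ using (ℤ)
import Data.Integer.Properties as ℤ
open import Data.List as List using (List; []; _∷_; map; length; filter)
import Data.List.Properties as List
open import Data.List.Membership.Propositional using (_∈_; find; lose)
import Data.List.Membership.Propositional.Properties as ∈
open import Data.List.Membership.Propositional.Properties.WithK using (unique∧set⇒bag)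
open import Data.List.Relation.Binary.BagAndSetEquality using (∼bag⇒↭)
open import Data.List.Relation.Binary.Permutation.Propositional using (_↭_; ↭-sym; ↭⇒↭ₛ)
import Data.List.Relation.Binary.Permutation.Propositional.Properties as ↭
open import Data.List.Relation.Binary.Permutation.Setoid.Properties using (foldr-commMonoid)
open import Data.List.Relation.Unary.All as All using (All; []; _∷_)
import Data.List.Relation.Unary.All.Properties as All
open import Data.List.Relation.Unary.AllPairs using ([]; _∷_)
open import Data.List.Relation.Unary.Any as Any using (Any; here; there)
open import Data.List.Relation.Unary.Unique.Propositional using (Unique)
import Data.List.Relation.Unary.Unique.Propositional.Properties as Unique
import Data.List.Relation.Unary.Unique.DecPropositional.Properties as Unique
open import Data.Nat using (ℕ; zero; suc; _≤_; _<_; _≤?_; z≤n; s≤s)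
import Data.Nat.Properties as ℕ
open import Data.Product using (Σ; ∃-syntax; _×_; _,_)
open import Data.Rational as ℚ using (ℚ; 0ℚ; 1ℚ; _+_; _*_; -_; _-_)
import Data.Rational.Properties as ℚ
open import Data.Rational.Solver using (module +-*-Solver)
open import Data.Vec as Vec using (Vec; []; _∷_; lookup; tabulate; foldr′)
import Data.Vec.Properties as Vec
open import Function using (_∘_; mk⇔)
open import Level using (0ℓ)
open import Relation.Binary.Bundles using (DecTotalOrder)
open import Relation.Binary.Definitions using (DecidableEquality; tri<; tri≈; tri>)
open import Relation.Binary.PropositionalEquality
open import Relation.Nullary using (Dec; yes; no; does)
open import Relation.Nullary.Decidable using (dec-true; dec-false; ¬?; _×-dec_)
open import Data.List.Extrema (DecTotalOrder.totalOrder ℚ.≤-decTotalOrder)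
  using (argmin; argmin-all; f[argmin]≤f[xs])

open +-*-Solver

private
  variable
    A B C : Set
    n k : ℕ

-- Rational arithmetic and finite sums

≤∧≢⇒< : ∀ {p q} → p ℚ.≤ q → p ≢ q → p ℚ.< q
≤∧≢⇒< {p} {q} p≤q p≢q with ℚ.<-cmp p q
... | tri< p<q _ _ = p<q
... | tri≈ _ p≡q _ = ⊥-elim (p≢q p≡q)
... | tri> _ _ q<p = ⊥-elim (ℚ.<-irrefl refl (ℚ.<-≤-trans q<p p≤q))

p≤q⇒0≤q-p : ∀ {p q} → p ℚ.≤ q → 0ℚ ℚ.≤ q - p
p≤q⇒0≤q-p {p} {q} p≤q = subst (ℚ._≤ q - p) (ℚ.+-inverseʳ p) (ℚ.+-monoˡ-≤ (- p) p≤q)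

*-nonNeg : ∀ {p q} → 0ℚ ℚ.≤ p → 0ℚ ℚ.≤ q → 0ℚ ℚ.≤ p * q
*-nonNeg {p} {q} 0≤p 0≤q =
  ℚ.nonNegative⁻¹ (p * q) {{ℚ.nonNeg*nonNeg⇒nonNeg p {{ℚ.nonNegative 0≤p}} q {{ℚ.nonNegative 0≤q}}}}

*-pos : ∀ {p q} → 0ℚ ℚ.< p → 0ℚ ℚ.< q → 0ℚ ℚ.< p * q
*-pos {p} {q} 0<p 0<q = ℚ.positive⁻¹ (p * q) {{ℚ.pos*pos⇒pos p {{ℚ.positive 0<p}} q {{ℚ.positive 0<q}}}}

p≡0⇒p*q≡0 : ∀ {p} q → p ≡ 0ℚ → p * q ≡ 0ℚ
p≡0⇒p*q≡0 q refl = ℚ.*-zeroˡ q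

sumℚ≡foldr : ∀ xs → sumℚ xs ≡ List.foldr _+_ 0ℚ xs
sumℚ≡foldr [] = refl
sumℚ≡foldr (x ∷ xs) = cong (x +_) (sumℚ≡foldr xs)

sumℚ-↭ : ∀ {xs ys} → xs ↭ ys → sumℚ xs ≡ sumℚ ys
sumℚ-↭ {xs} {ys} xs↭ys = begin
  sumℚ xs               ≡⟨ sumℚ≡foldr xs ⟩
  List.foldr _+_ 0ℚ xs  ≡⟨ foldr-commMonoid (setoid ℚ) ℚ.+-0-isCommutativeMonoid (↭⇒↭ₛ xs↭ys) ⟩
  List.foldr _+_ 0ℚ ys  ≡⟨ sumℚ≡foldr ys ⟨
  sumℚ ys               ∎
  where open ≡-Reasoning

sumℚ-cong : ∀ {f g : A → ℚ} xs → (∀ {x} → x ∈ xs → f x ≡ g x) →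
  sumℚ (map f xs) ≡ sumℚ (map g xs)
sumℚ-cong [] f≡g = refl
sumℚ-cong (x ∷ xs) f≡g = cong₂ _+_ (f≡g (here refl)) (sumℚ-cong xs (f≡g ∘ there))

sumℚ-zero : ∀ {f : A → ℚ} xs → (∀ {x} → x ∈ xs → f x ≡ 0ℚ) → sumℚ (map f xs) ≡ 0ℚ
sumℚ-zero [] f≡0 = refl
sumℚ-zero (x ∷ xs) f≡0 = cong₂ _+_ (f≡0 (here refl)) (sumℚ-zero xs (f≡0 ∘ there))

sumℚ-map-+ : ∀ (f g : A → ℚ) xs →
  sumℚ (map (λ x → f x + g x) xs) ≡ sumℚ (map f xs) + sumℚ (map g xs)
sumℚ-map-+ f g [] = refl
sumℚ-map-+ f g (x ∷ xs) rewrite sumℚ-map-+ f g xs =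
  solve 4 (λ a b c d → (a :+ b) :+ (c :+ d) := (a :+ c) :+ (b :+ d)) refl (f x) (g x) _ _

sumℚ-map-*ˡ : ∀ c (f : A → ℚ) xs → sumℚ (map (λ x → c * f x) xs) ≡ c * sumℚ (map f xs)
sumℚ-map-*ˡ c f [] = sym (ℚ.*-zeroʳ c)
sumℚ-map-*ˡ c f (x ∷ xs) rewrite sumℚ-map-*ˡ c f xs = sym (ℚ.*-distribˡ-+ c (f x) _)

sumℚ-map-*ʳ : ∀ c (f : A → ℚ) xs → sumℚ (map (λ x → f x * c) xs) ≡ sumℚ (map f xs) * c
sumℚ-map-*ʳ c f [] = sym (ℚ.*-zeroˡ c)
sumℚ-map-*ʳ c f (x ∷ xs) rewrite sumℚ-map-*ʳ c f xs = sym (ℚ.*-distribʳ-+ c (f x) _)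

sumℚ-swap : ∀ (F : A → B → ℚ) xs ys →
  sumℚ (map (λ x → sumℚ (map (F x) ys)) xs) ≡ sumℚ (map (λ y → sumℚ (map (λ x → F x y) xs)) ys)
sumℚ-swap F [] ys = sym (sumℚ-zero ys (λ _ → refl))
sumℚ-swap F (x ∷ xs) ys rewrite sumℚ-swap F xs ys = sym (sumℚ-map-+ (F x) _ ys)

sumℚ-nonneg : ∀ (f : A → ℚ) xs → All (λ x → 0ℚ ℚ.≤ f x) xs → 0ℚ ℚ.≤ sumℚ (map f xs)
sumℚ-nonneg f [] [] = ℚ.≤-refl
sumℚ-nonneg f (x ∷ xs) (fx≥0 ∷ fxs≥0) = ℚ.+-mono-≤ fx≥0 (sumℚ-nonneg f xs fxs≥0)

sumℚ-pos : ∀ (f : A → ℚ) {xs y} → All (λ x → 0ℚ ℚ.≤ f x) xs → y ∈ xs → 0ℚ ℚ.< f y →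
  0ℚ ℚ.< sumℚ (map f xs)
sumℚ-pos f {x ∷ xs} (_ ∷ fxs≥0) (here refl) fy>0 = ℚ.+-mono-<-≤ fy>0 (sumℚ-nonneg f xs fxs≥0)
sumℚ-pos f (fx≥0 ∷ fxs≥0) (there y∈xs) fy>0 = ℚ.+-mono-≤-< fx≥0 (sumℚ-pos f fxs≥0 y∈xs fy>0)

-- The cube and its support

allPoints-complete : ∀ (x : Cube n) → x ∈ allPoints n
allPoints-complete [] = here refl
allPoints-complete {suc n} (true ∷ x) = ∈.∈-++⁺ˡ (∈.∈-map⁺ (true ∷_) (allPoints-complete x))
allPoints-complete {suc n} (false ∷ x) =
  ∈.∈-++⁺ʳ (map (true ∷_) (allPoints n)) (∈.∈-map⁺ (false ∷_) (allPoints-complete x))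

allPoints-unique : ∀ n → Unique (allPoints n)
allPoints-unique zero = [] ∷ []
allPoints-unique (suc n) =
  Unique.++⁺ (Unique.map⁺ Vec.∷-injectiveʳ (allPoints-unique n))
             (Unique.map⁺ Vec.∷-injectiveʳ (allPoints-unique n))
             heads-differ
  where
  heads-differ : ∀ {x} → x ∈ map (true ∷_) (allPoints n) × x ∈ map (false ∷_) (allPoints n) → ⊥
  heads-differ (p , q) with ∈.∈-map⁻ (true ∷_) p | ∈.∈-map⁻ (false ∷_) q
  ... | _ , _ , refl | _ , _ , ()

sumℚ-allPoints-reindex : ∀ (σ τ : Cube n → Cube n) →
  (∀ x → τ (σ x) ≡ x) → (∀ x → σ (τ x) ≡ x) →
  ∀ f → sumℚ (map (f ∘ σ) (allPoints n)) ≡ sumℚ (map f (allPoints n))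
sumℚ-allPoints-reindex {n} σ τ τ∘σ σ∘τ f =
  trans (cong sumℚ (List.map-∘ (allPoints n))) (sumℚ-↭ (↭.map⁺ f σ[allPoints]↭allPoints))
  where
  σ-injective : ∀ {x y} → σ x ≡ σ y → x ≡ y
  σ-injective {x} {y} σx≡σy = trans (sym (τ∘σ x)) (trans (cong τ σx≡σy) (τ∘σ y))
  σ[allPoints]↭allPoints : map σ (allPoints n) ↭ allPoints n
  σ[allPoints]↭allPoints = ∼bag⇒↭ (unique∧set⇒bag
    (Unique.map⁺ σ-injective (allPoints-unique n)) (allPoints-unique n)
    (λ {y} → mk⇔ (λ _ → allPoints-complete y)
                 (λ _ → subst (_∈ map σ (allPoints n)) (σ∘τ y)
                              (∈.∈-map⁺ σ (allPoints-complete (τ y))))))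

chi-⊥ : ∀ (x : Cube n) → chi Subset.⊥ x ≡ 1ℚ
chi-⊥ [] = refl
chi-⊥ (b ∷ x) = trans (ℚ.*-identityˡ _) (chi-⊥ x)

sumℚ≡expect-chi-⊥ : ∀ (D : Distribution n) → sumℚ (map D (allPoints n)) ≡ expect D (chi Subset.⊥)
sumℚ≡expect-chi-⊥ {n} D = sumℚ-cong (allPoints n) (λ {x} _ →
  trans (sym (ℚ.*-identityʳ (D x))) (cong (D x *_) (sym (chi-⊥ x))))

support : Distribution n → List (Cube n)
support {n} D = filter (λ x → ¬? (D x ℚ.≟ 0ℚ)) (allPoints n)

∈-support : ∀ {D : Distribution n} {x} → D x ≢ 0ℚ → x ∈ support D
∈-support {D = D} {x} = ∈.∈-filter⁺ (λ x → ¬? (D x ℚ.≟ 0ℚ)) (allPoints-complete x)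

support-≢0 : ∀ (D : Distribution n) → All (λ x → D x ≢ 0ℚ) (support D)
support-≢0 {n} D = All.all-filter (λ x → ¬? (D x ℚ.≟ 0ℚ)) (allPoints n)

-- Permuting coordinates

permuteVec : Permutation′ n → Vec A n → Vec A n
permuteVec π v = tabulate (λ i → lookup v (π ⟨$⟩ʳ i))

lookup-permuteVec : ∀ (π : Permutation′ n) (v : Vec A n) i →
  lookup (permuteVec π v) i ≡ lookup v (π ⟨$⟩ʳ i)
lookup-permuteVec π v = Vec.lookup∘tabulate _

permuteVec-∘ : ∀ (π σ : Permutation′ n) (v : Vec A n) →
  permuteVec σ (permuteVec π v) ≡ permuteVec (σ Perm.∘ₚ π) v
permuteVec-∘ π σ v = Vec.tabulate-cong (λ i → lookup-permuteVec π v (σ ⟨$⟩ʳ i))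

permuteVec-inverseˡ : ∀ (π : Permutation′ n) (v : Vec A n) → permuteVec (Perm.flip π) (permuteVec π v) ≡ v
permuteVec-inverseˡ π v = trans (permuteVec-∘ π (Perm.flip π) v)
  (trans (Vec.tabulate-cong (λ i → cong (lookup v) (Perm.inverseʳ π))) (Vec.tabulate∘lookup v))

permuteVec-inverseʳ : ∀ (π : Permutation′ n) (v : Vec A n) → permuteVec π (permuteVec (Perm.flip π) v) ≡ v
permuteVec-inverseʳ π v = trans (permuteVec-∘ (Perm.flip π) π v)
  (trans (Vec.tabulate-cong (λ i → cong (lookup v) (Perm.inverseˡ π))) (Vec.tabulate∘lookup v))

map-permuteVec : ∀ (f : A → B) (π : Permutation′ n) v →
  Vec.map f (permuteVec π v) ≡ permuteVec π (Vec.map f v)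
map-permuteVec f π v = trans (sym (Vec.tabulate-∘ f _))
  (Vec.tabulate-cong (λ i → sym (Vec.lookup-map (π ⟨$⟩ʳ i) f v)))

zipWith-permuteVec : ∀ (f : A → B → C) (π : Permutation′ n) u v →
  Vec.zipWith f (permuteVec π u) (permuteVec π v) ≡ permuteVec π (Vec.zipWith f u v)
zipWith-permuteVec f π u v = trans (sym (Vec.tabulate∘lookup _)) (Vec.tabulate-cong (λ i → begin
  lookup (Vec.zipWith f (permuteVec π u) (permuteVec π v)) i
    ≡⟨ Vec.lookup-zipWith f i (permuteVec π u) (permuteVec π v) ⟩
  f (lookup (permuteVec π u) i) (lookup (permuteVec π v) i)
    ≡⟨ cong₂ f (lookup-permuteVec π u i) (lookup-permuteVec π v i) ⟩
  f (lookup u (π ⟨$⟩ʳ i)) (lookup v (π ⟨$⟩ʳ i))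
    ≡⟨ Vec.lookup-zipWith f (π ⟨$⟩ʳ i) u v ⟨
  lookup (Vec.zipWith f u v) (π ⟨$⟩ʳ i) ∎))
  where open ≡-Reasoning

zipWith-cong : ∀ {f g : A → B → C} → (∀ a b → f a b ≡ g a b) →
  ∀ (u : Vec A n) v → Vec.zipWith f u v ≡ Vec.zipWith g u v
zipWith-cong f≡g [] [] = refl
zipWith-cong f≡g (a ∷ u) (b ∷ v) = cong₂ _∷_ (f≡g a b) (zipWith-cong f≡g u v)

module _ (M : CommutativeMonoid 0ℓ 0ℓ) where
  open CommutativeMonoid M using (Carrier; _≈_; _∙_; ε; ∙-congˡ)
    renaming (refl to ≈-refl; trans to ≈-trans; reflexive to ≈-reflexive)
  open FinSum M using (sum; sum-cong-≗; sum-permute)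

  foldr′≈sum : ∀ (v : Vec Carrier n) → foldr′ _∙_ ε v ≈ sum (lookup v)
  foldr′≈sum [] = ≈-refl
  foldr′≈sum (x ∷ v) = ∙-congˡ (foldr′≈sum v)

  foldr′-permuteVec : ∀ (π : Permutation′ n) (v : Vec Carrier n) →
    foldr′ _∙_ ε (permuteVec π v) ≈ foldr′ _∙_ ε v
  foldr′-permuteVec π v = begin
    foldr′ _∙_ ε (permuteVec π v)    ≈⟨ foldr′≈sum (permuteVec π v) ⟩
    sum (lookup (permuteVec π v))    ≡⟨ sum-cong-≗ (lookup-permuteVec π v) ⟩
    sum (λ i → lookup v (π ⟨$⟩ʳ i))  ≈⟨ sum-permute (lookup v) π ⟨
    sum (lookup v)                   ≈⟨ foldr′≈sum v ⟨
    foldr′ _∙_ ε v                   ∎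
    where open import Relation.Binary.Reasoning.Setoid (CommutativeMonoid.setoid M)

  foldr′-zipWith-permuteVec : ∀ (f : A → B → Carrier) (π : Permutation′ n) u v →
    foldr′ _∙_ ε (Vec.zipWith f (permuteVec π u) (permuteVec π v)) ≈ foldr′ _∙_ ε (Vec.zipWith f u v)
  foldr′-zipWith-permuteVec f π u v =
    ≈-trans (≈-reflexive (cong (foldr′ _∙_ ε) (zipWith-permuteVec f π u v)))
            (foldr′-permuteVec π (Vec.zipWith f u v))

coordSum-permute : ∀ (π : Permutation′ n) x → coordSum (permute π x) ≡ coordSum x
coordSum-permute π x = trans (cong (foldr′ ℤ._+_ (ℤ.+ 0)) (map-permuteVec signℤ π x))
                             (foldr′-permuteVec ℤ.+-0-commutativeMonoid π (Vec.map signℤ x))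

chiFactor : Bool → Bool → ℚ
chiFactor true b = signℚ b
chiFactor false b = 1ℚ

-- The factor function of chi is local to its definition, hence not nameable here.
chi≡product : ∀ (T : Subset n) x → chi T x ≡ foldr′ _*_ 1ℚ (Vec.zipWith chiFactor T x)
chi≡product T x = cong (foldr′ _*_ 1ℚ) (zipWith-cong (λ { true b → refl ; false b → refl }) T x)

chi-permute : ∀ (π : Permutation′ n) T x → chi (permute π T) (permute π x) ≡ chi T x
chi-permute π T x = begin
  chi (permute π T) (permute π x)
    ≡⟨ chi≡product (permute π T) (permute π x) ⟩
  foldr′ _*_ 1ℚ (Vec.zipWith chiFactor (permute π T) (permute π x))
    ≡⟨ foldr′-zipWith-permuteVec ℚ.*-1-commutativeMonoid chiFactor π T x ⟩
  foldr′ _*_ 1ℚ (Vec.zipWith chiFactor T x)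
    ≡⟨ chi≡product T x ⟨
  chi T x ∎
  where open ≡-Reasoning

expect-chi-permute : ∀ {g : Distribution n} → Symmetric g → ∀ π T →
  expect g (chi (permute π T)) ≡ expect g (chi T)
expect-chi-permute {n} {g} g-sym π T = begin
  sumℚ (map (λ x → g x * chi (permute π T) x) (allPoints n))
    ≡⟨ sumℚ-allPoints-reindex (permute π) (permute (Perm.flip π))
         (permuteVec-inverseˡ π) (permuteVec-inverseʳ π) _ ⟨
  sumℚ (map (λ y → g (permute π y) * chi (permute π T) (permute π y)) (allPoints n))
    ≡⟨ sumℚ-cong (allPoints n) (λ {y} _ → cong₂ _*_ (g-sym π y) (chi-permute π T y)) ⟩
  sumℚ (map (λ y → g y * chi T y) (allPoints n)) ∎
  where open ≡-Reasoning

data _∼ₚ_ (u v : Vec A n) : Set where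
  _by_ : (π : Permutation′ n) → permuteVec π u ≡ v → u ∼ₚ v

∼ₚ-refl : ∀ (v : Vec A n) → v ∼ₚ v
∼ₚ-refl v = Perm.id by Vec.tabulate∘lookup v

∼ₚ-trans : ∀ {u v w : Vec A n} → u ∼ₚ v → v ∼ₚ w → u ∼ₚ w
∼ₚ-trans {u = u} (π by refl) (σ by refl) = (σ Perm.∘ₚ π) by sym (permuteVec-∘ π σ u)

∼ₚ-∷ : ∀ a {u v : Vec A n} → u ∼ₚ v → (a ∷ u) ∼ₚ (a ∷ v)
∼ₚ-∷ a (π by refl) = Perm.lift₀ π by refl

∼ₚ-swap : ∀ a b (v : Vec A n) → (a ∷ b ∷ v) ∼ₚ (b ∷ a ∷ v)
∼ₚ-swap a b v =
  Perm.transpose Fin.zero (Fin.suc Fin.zero) by cong (λ w → b ∷ a ∷ w) (Vec.tabulate∘lookup v)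

initialSegment : ℕ → (n : ℕ) → Subset n
initialSegment zero n = Subset.⊥
initialSegment (suc t) zero = []
initialSegment (suc t) (suc n) = true ∷ initialSegment t n

false∷initialSegment : ∀ t n → t ≤ n → (false ∷ initialSegment t n) ∼ₚ initialSegment t (suc n)
false∷initialSegment zero n _ = ∼ₚ-refl _
false∷initialSegment (suc t) (suc n) (s≤s t≤n) =
  ∼ₚ-trans (∼ₚ-swap false true _) (∼ₚ-∷ true (false∷initialSegment t n t≤n))

∼ₚ-initialSegment : ∀ (T : Subset n) → T ∼ₚ initialSegment ∣ T ∣ n
∼ₚ-initialSegment [] = ∼ₚ-refl []
∼ₚ-initialSegment (true ∷ T) = ∼ₚ-∷ true (∼ₚ-initialSegment T)
∼ₚ-initialSegment {suc n} (false ∷ T) =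
  ∼ₚ-trans (∼ₚ-∷ false (∼ₚ-initialSegment T))
           (false∷initialSegment ∣ T ∣ n (Subset.∣p∣≤n T))

expect-chi-initialSegment : ∀ {g : Distribution n} → Symmetric g → ∀ T →
  expect g (chi T) ≡ expect g (chi (initialSegment ∣ T ∣ n))
expect-chi-initialSegment {g = g} g-sym T with π by permuteT≡segment ← ∼ₚ-initialSegment T =
  trans (sym (expect-chi-permute g-sym π T)) (cong (λ S → expect g (chi S)) permuteT≡segment)

-- Homogeneous linear systems with fewer equations than unknowns

∈⇒↭-∷ : ∀ {x : A} {xs} → x ∈ xs → ∃[ ys ] xs ↭ x ∷ ys
∈⇒↭-∷ x∈xs with ys , zs , refl ← ∈.∈-∃++ x∈xs = ys List.++ zs , ↭.shift _ ys zs

module LinearAlgebra {A : Set} (_≟_ : DecidableEquality A) where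

  δ : A → A → ℚ
  δ v w = if does (v ≟ w) then 1ℚ else 0ℚ

  δ-refl : ∀ v → δ v v ≡ 1ℚ
  δ-refl v rewrite dec-true (v ≟ v) refl = refl

  δ-≢ : ∀ {v w} → v ≢ w → δ v w ≡ 0ℚ
  δ-≢ {v} {w} v≢w rewrite dec-false (v ≟ w) v≢w = refl

  sumℚ-δ : ∀ {L} → Unique L → ∀ {w} → w ∈ L → ∀ (c : A → ℚ) →
    sumℚ (map (λ v → δ w v * c v) L) ≡ c w
  sumℚ-δ {w ∷ L} (w∉L ∷ _) {.w} (here refl) c = begin
    δ w w * c w + sumℚ (map (λ v → δ w v * c v) L)
      ≡⟨ cong₂ _+_ (cong (_* c w) (δ-refl w))
                   (sumℚ-zero L (λ {v} v∈L → p≡0⇒p*q≡0 (c v) (δ-≢ (All.lookup w∉L v∈L)))) ⟩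
    1ℚ * c w + 0ℚ
      ≡⟨ trans (ℚ.+-identityʳ _) (ℚ.*-identityˡ (c w)) ⟩
    c w ∎
    where open ≡-Reasoning
  sumℚ-δ {u ∷ L} (u∉L ∷ L!) {w} (there w∈L) c = begin
    δ w u * c u + sumℚ (map (λ v → δ w v * c v) L)
      ≡⟨ cong₂ _+_ (p≡0⇒p*q≡0 (c u) (δ-≢ (λ w≡u → All.lookup u∉L w∈L (sym w≡u))))
                   (sumℚ-δ L! w∈L c) ⟩
    0ℚ + c w
      ≡⟨ ℚ.+-identityˡ (c w) ⟩
    c w ∎
    where open ≡-Reasoning

  extend : A → ℚ → (A → ℚ) → A → ℚ
  extend v q c w = if does (v ≟ w) then q else c w

  extend-≢ : ∀ {v w} q c → v ≢ w → extend v q c w ≡ c w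
  extend-≢ {v} {w} q c v≢w rewrite dec-false (v ≟ w) v≢w = refl

  dot : List A → (A → ℚ) → (A → ℚ) → ℚ
  dot L a c = sumℚ (map (λ v → a v * c v) L)

  dot-linearˡ : ∀ L a b k c → dot L (λ w → a w + k * b w) c ≡ dot L a c + k * dot L b c
  dot-linearˡ L a b k c = begin
    sumℚ (map (λ w → (a w + k * b w) * c w) L)
      ≡⟨ sumℚ-cong L (λ {w} _ →
           solve 4 (λ aw bw kk cw → (aw :+ kk :* bw) :* cw := aw :* cw :+ kk :* (bw :* cw))
                   refl (a w) (b w) k (c w)) ⟩
    sumℚ (map (λ w → a w * c w + k * (b w * c w)) L)
      ≡⟨ sumℚ-map-+ _ _ L ⟩
    dot L a c + sumℚ (map (λ w → k * (b w * c w)) L)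
      ≡⟨ cong (dot L a c +_) (sumℚ-map-*ˡ k _ L) ⟩
    dot L a c + k * dot L b c ∎
    where open ≡-Reasoning

  dot-extend : ∀ {v L} → All (v ≢_) L → ∀ a q c → dot (v ∷ L) a (extend v q c) ≡ a v * q + dot L a c
  dot-extend {v} {L} v∉L a q c rewrite dec-true (v ≟ v) refl =
    cong (a v * q +_) (sumℚ-cong L (λ {w} w∈L → cong (a w *_) (extend-≢ q c (All.lookup v∉L w∈L))))

  dot-δ : ∀ {v L} → All (v ≢_) L → ∀ a → a v ≡ 0ℚ → dot (v ∷ L) a (δ v) ≡ 0ℚ
  dot-δ {v} {L} v∉L a av≡0 = cong₂ _+_ (p≡0⇒p*q≡0 (δ v v) av≡0)
    (sumℚ-zero L (λ {w} w∈L → trans (cong (a w *_) (δ-≢ (All.lookup v∉L w∈L))) (ℚ.*-zeroʳ (a w))))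

  -- Gaussian elimination of the unknown at v, using the row a as pivot.
  module Pivot {v L} (v∉L : All (v ≢_) L) (a : A → ℚ) (av≢0 : a v ≢ 0ℚ) where

    instance
      av-nonZero : ℚ.NonZero (a v)
      av-nonZero = ℚ.≢-nonZero av≢0

    ratio : (A → ℚ) → ℚ
    ratio b = b v * ℚ.1/ (a v)

    eliminate : (A → ℚ) → A → ℚ
    eliminate b w = b w + (- ratio b) * a w

    lift : (A → ℚ) → A → ℚ
    lift c′ = extend v (- dot L a c′ * ℚ.1/ (a v)) c′

    dot-lift-pivot : ∀ c′ → dot (v ∷ L) a (lift c′) ≡ 0ℚ
    dot-lift-pivot c′ = begin
      dot (v ∷ L) a (lift c′)  ≡⟨ dot-extend v∉L a _ c′ ⟩
      a v * (- s * ia) + s     ≡⟨ solve 3 (λ av s ia → av :* (:- s :* ia) :+ s := :- s :* (av :* ia) :+ s)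
                                          refl (a v) s ia ⟩
      - s * (a v * ia) + s     ≡⟨ cong (λ z → - s * z + s) (ℚ.*-inverseʳ (a v)) ⟩
      - s * 1ℚ + s             ≡⟨ cong (_+ s) (ℚ.*-identityʳ (- s)) ⟩
      - s + s                  ≡⟨ ℚ.+-inverseˡ s ⟩
      0ℚ                       ∎
      where
      open ≡-Reasoning
      s = dot L a c′
      ia = ℚ.1/ (a v)

    dot-lift : ∀ b c′ → dot (v ∷ L) b (lift c′) ≡ dot L (eliminate b) c′
    dot-lift b c′ = begin
      dot (v ∷ L) b (lift c′)                 ≡⟨ dot-extend v∉L b _ c′ ⟩
      b v * (- dot L a c′ * ia) + dot L b c′
        ≡⟨ solve 4 (λ bv s ia d → bv :* (:- s :* ia) :+ d := d :+ (:- (bv :* ia)) :* s)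
                   refl (b v) (dot L a c′) ia (dot L b c′) ⟩
      dot L b c′ + (- ratio b) * dot L a c′   ≡⟨ dot-linearˡ L b a (- ratio b) c′ ⟨
      dot L (eliminate b) c′                  ∎
      where
      open ≡-Reasoning
      ia = ℚ.1/ (a v)

  nontrivial-solution : ∀ L → Unique L → (R : List (A → ℚ)) → length R < length L →
    ∃[ c ] All (λ a → dot L a c ≡ 0ℚ) R × Any (λ v → c v ≢ 0ℚ) L
  nontrivial-solution (v ∷ L) (v∉L ∷ L!) R |R|<|L| with All.all? (λ a → a v ℚ.≟ 0ℚ) R
  ... | yes R[v]≡0 =
    δ v , All.map (λ {a} → dot-δ v∉L a) R[v]≡0 ,
    here (λ δvv≡0 → ℚ.1≢0 (trans (sym (δ-refl v)) δvv≡0))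
  ... | no ¬R[v]≡0
    with a , a∈R , av≢0 ← find (All.¬All⇒Any¬ (λ a → a v ℚ.≟ 0ℚ) R ¬R[v]≡0)
    with R′ , R↭a∷R′ ← ∈⇒↭-∷ a∈R
    = lift-solution (nontrivial-solution L L! (map eliminate R′) |R′|<|L|)
    where
    open Pivot v∉L a av≢0
    |R′|<|L| : length (map eliminate R′) < length L
    |R′|<|L| rewrite List.length-map eliminate R′ | ↭.↭-length R↭a∷R′ = ℕ.≤-pred |R|<|L|
    lift-solution :
      ∃[ c′ ] All (λ b → dot L b c′ ≡ 0ℚ) (map eliminate R′) × Any (λ w → c′ w ≢ 0ℚ) L →
      ∃[ c ] All (λ b → dot (v ∷ L) b c ≡ 0ℚ) R × Any (λ w → c w ≢ 0ℚ) (v ∷ L)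
    lift-solution (c′ , c′⊥R′ , c′≢0) with w , w∈L , c′w≢0 ← find c′≢0 =
      lift c′ ,
      ↭.All-resp-↭ (↭-sym R↭a∷R′)
        (dot-lift-pivot c′ ∷ All.map (λ {b} → trans (dot-lift b c′)) (All.map⁻ c′⊥R′)) ,
      there (lose w∈L (λ cw≡0 → c′w≢0 (trans (sym (extend-≢ _ c′ (All.lookup v∉L w∈L))) cw≡0)))

open LinearAlgebra ℤ._≟_ using (δ; dot; sumℚ-δ; nontrivial-solution)

-- Reweighting and the moment equations

reweight : Distribution n → (Cube n → ℚ) → Distribution n
reweight D h x = D x * h x

reweight-symmetric : ∀ {D h : Distribution n} → Symmetric D → Symmetric h → Symmetric (reweight D h)
reweight-symmetric D-sym h-sym π x = cong₂ _*_ (D-sym π x) (h-sym π x)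

∘coordSum-symmetric : ∀ (c : ℤ → ℚ) → Symmetric {n} (c ∘ coordSum)
∘coordSum-symmetric c π x = cong c (coordSum-permute π x)

Balanced : ℕ → Distribution n → Set
Balanced k g = ∀ T → ∣ T ∣ ≤ k → expect g (chi T) ≡ 0ℚ

∣⊥∣≤ : ∀ n k → ∣ Subset.⊥ {n = n} ∣ ≤ k
∣⊥∣≤ n k = subst (_≤ k) (sym (Subset.∣⊥∣≡0 n)) z≤n

Balanced⇒sum≡0 : ∀ {g : Distribution n} → Balanced k g → sumℚ (map g (allPoints n)) ≡ 0ℚ
Balanced⇒sum≡0 {n} {k} {g} g-balanced =
  trans (sumℚ≡expect-chi-⊥ g) (g-balanced Subset.⊥ (∣⊥∣≤ n k))

levelRow : Distribution n → (Cube n → ℚ) → ℤ → ℚ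
levelRow D f v = expect D (λ x → δ (coordSum x) v * f x)

dot-levelRow : ∀ {D : Distribution n} {L} → Unique L → SumSupportedOn D (ListSet L) → ∀ f c →
  dot L (levelRow D f) c ≡ expect (reweight D (c ∘ coordSum)) f
dot-levelRow {n} {D} {L} L! supp f c = begin
  sumℚ (map (λ v → sumℚ (map (λ x → D x * (δ (coordSum x) v * f x)) cube) * c v) L)
    ≡⟨ sumℚ-cong L (λ {v} _ → sym (sumℚ-map-*ʳ (c v) _ cube)) ⟩
  sumℚ (map (λ v → sumℚ (map (λ x → D x * (δ (coordSum x) v * f x) * c v) cube)) L)
    ≡⟨ sumℚ-swap (λ v x → D x * (δ (coordSum x) v * f x) * c v) L cube ⟩
  sumℚ (map (λ x → sumℚ (map (λ v → D x * (δ (coordSum x) v * f x) * c v) L)) cube)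
    ≡⟨ sumℚ-cong cube (λ {x} _ → sum-over-levels x) ⟩
  sumℚ (map (λ x → D x * c (coordSum x) * f x) cube) ∎
  where
  open ≡-Reasoning
  cube = allPoints n
  sum-over-levels : ∀ x →
    sumℚ (map (λ v → D x * (δ (coordSum x) v * f x) * c v) L) ≡ D x * c (coordSum x) * f x
  sum-over-levels x = begin
    sumℚ (map (λ v → D x * (δ s v * f x) * c v) L)
      ≡⟨ sumℚ-cong L (λ {v} _ → solve 4 (λ d e fx cv → d :* (e :* fx) :* cv := (d :* fx) :* (e :* cv))
                                         refl (D x) (δ s v) (f x) (c v)) ⟩
    sumℚ (map (λ v → (D x * f x) * (δ s v * c v)) L)
      ≡⟨ sumℚ-map-*ˡ (D x * f x) _ L ⟩
    (D x * f x) * sumℚ (map (λ v → δ s v * c v) L)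
      ≡⟨ select-level ⟩
    (D x * f x) * c s
      ≡⟨ solve 3 (λ d fx cs → (d :* fx) :* cs := d :* cs :* fx) refl (D x) (f x) (c s) ⟩
    D x * c s * f x ∎
    where
    s = coordSum x
    select-level : (D x * f x) * sumℚ (map (λ v → δ s v * c v) L) ≡ (D x * f x) * c s
    select-level with D x ℚ.≟ 0ℚ
    ... | yes Dx≡0 = let Dxfx≡0 = p≡0⇒p*q≡0 (f x) Dx≡0 in
                     trans (p≡0⇒p*q≡0 _ Dxfx≡0) (sym (p≡0⇒p*q≡0 _ Dxfx≡0))
    ... | no Dx≢0 = cong (D x * f x *_) (sumℚ-δ L! (supp x Dx≢0) c)

momentRow : Distribution n → ℕ → ℤ → ℚ
momentRow {n} D t = levelRow D (chi (initialSegment t n))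

balanced-reweight : ∀ {D : Distribution n} {L c} → Symmetric D → Unique L → SumSupportedOn D (ListSet L) →
  All (λ a → dot L a c ≡ 0ℚ) (List.applyUpTo (momentRow D) (suc k)) →
  Balanced k (reweight D (c ∘ coordSum))
balanced-reweight {n} {k} {D} {L} {c} D-sym L! supp c⊥rows T ∣T∣≤k = begin
  expect g (chi T)                         ≡⟨ expect-chi-initialSegment g-sym T ⟩
  expect g (chi (initialSegment ∣ T ∣ n))  ≡⟨ dot-levelRow L! supp _ c ⟨
  dot L (momentRow D ∣ T ∣) c
    ≡⟨ All.applyUpTo⁻ (momentRow D) (suc k) c⊥rows (s≤s ∣T∣≤k) ⟩
  0ℚ                                       ∎
  where
  open ≡-Reasoning
  g = reweight D (c ∘ coordSum)
  g-sym = reweight-symmetric D-sym (∘coordSum-symmetric c)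

-- Moving a distribution along a balanced direction

SymmetricKUniform : ℕ → Distribution n → Set
SymmetricKUniform k D = IsDistribution D × Symmetric D × KUniform k D

lowerBound-negative : ∀ {D h : Cube n → ℚ} {μ x₀} →
  (∀ x → 0ℚ ℚ.≤ D x) → expect D h ≡ 0ℚ → D x₀ ≢ 0ℚ → h x₀ ≢ 0ℚ →
  (∀ x → D x ≢ 0ℚ → μ ℚ.≤ h x) → μ ℚ.< 0ℚ
lowerBound-negative {n} {D} {h} {μ} {x₀} D≥0 E[h]≡0 Dx₀≢0 hx₀≢0 μ≤h with μ ℚ.<? 0ℚ
... | yes μ<0 = μ<0
... | no μ≮0 = ⊥-elim (ℚ.<-irrefl (sym E[h]≡0)
        (sumℚ-pos (reweight D h) (All.tabulate (λ {x} _ → Dh≥0 x)) (allPoints-complete x₀)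
                  (*-pos (≤∧≢⇒< (D≥0 x₀) (≢-sym Dx₀≢0))
                         (≤∧≢⇒< (h≥0 Dx₀≢0) (≢-sym hx₀≢0)))))
  where
  h≥0 : ∀ {x} → D x ≢ 0ℚ → 0ℚ ℚ.≤ h x
  h≥0 Dx≢0 = ℚ.≤-trans (ℚ.≮⇒≥ μ≮0) (μ≤h _ Dx≢0)
  Dh≥0 : ∀ x → 0ℚ ℚ.≤ D x * h x
  Dh≥0 x with D x ℚ.≟ 0ℚ
  ... | yes Dx≡0 = ℚ.≤-reflexive (sym (p≡0⇒p*q≡0 (h x) Dx≡0))
  ... | no Dx≢0 = *-nonNeg (D≥0 x) (h≥0 Dx≢0)

-- shifted = D · (1 − h/μ): with μ the minimum of h on the support, this is the
-- farthest point of the line D + λ·(D·h), λ ≥ 0, that is still nonnegative.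
module Shift {n} (D h : Cube n → ℚ) {μ} (μ<0 : μ ℚ.< 0ℚ) where

  instance
    -μ-positive : ℚ.Positive (- μ)
    -μ-positive = ℚ.positive (ℚ.neg-antimono-< μ<0)
    -μ-nonZero : ℚ.NonZero (- μ)
    -μ-nonZero = ℚ.pos⇒nonZero (- μ)

  scale : ℚ
  scale = ℚ.1/ (- μ)

  shifted : Distribution n
  shifted x = D x * (scale * (h x - μ))

  expect-shifted : ∀ f → expect shifted f ≡ scale * expect (reweight D h) f + expect D f
  expect-shifted f = begin
    sumℚ (map (λ x → D x * (scale * (h x - μ)) * f x) cube)
      ≡⟨ sumℚ-cong cube (λ {x} _ → solve 5 (λ d hx m sc fx →
           d :* (sc :* (hx :- m)) :* fx := sc :* (d :* hx :* fx) :+ sc :* (:- m) :* (d :* fx))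
           refl (D x) (h x) μ scale (f x)) ⟩
    sumℚ (map (λ x → scale * (D x * h x * f x) + scale * - μ * (D x * f x)) cube)
      ≡⟨ sumℚ-map-+ _ _ cube ⟩
    sumℚ (map (λ x → scale * (D x * h x * f x)) cube) + sumℚ (map (λ x → scale * - μ * (D x * f x)) cube)
      ≡⟨ cong₂ _+_ (sumℚ-map-*ˡ scale _ cube) (sumℚ-map-*ˡ (scale * - μ) _ cube) ⟩
    scale * expect (reweight D h) f + scale * - μ * expect D f
      ≡⟨ cong (λ z → scale * expect (reweight D h) f + z * expect D f) (ℚ.*-inverseˡ (- μ)) ⟩
    scale * expect (reweight D h) f + 1ℚ * expect D f
      ≡⟨ cong (scale * expect (reweight D h) f +_) (ℚ.*-identityˡ (expect D f)) ⟩
    scale * expect (reweight D h) f + expect D f ∎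
    where
    open ≡-Reasoning
    cube = allPoints n

  shifted-nonneg : (∀ x → 0ℚ ℚ.≤ D x) → (∀ x → D x ≢ 0ℚ → μ ℚ.≤ h x) →
    ∀ x → 0ℚ ℚ.≤ shifted x
  shifted-nonneg D≥0 μ≤h x with D x ℚ.≟ 0ℚ
  ... | yes Dx≡0 = ℚ.≤-reflexive (sym (p≡0⇒p*q≡0 _ Dx≡0))
  ... | no Dx≢0 = *-nonNeg (D≥0 x) (*-nonNeg (ℚ.<⇒≤ (ℚ.positive⁻¹ scale {{ℚ.1/pos⇒pos (- μ)}}))
                                             (p≤q⇒0≤q-p (μ≤h x Dx≢0)))

  shifted-vanishes : ∀ x → h x ≡ μ → shifted x ≡ 0ℚ
  shifted-vanishes x hx≡μ = begin
    D x * (scale * (h x - μ))  ≡⟨ cong (λ z → D x * (scale * (z - μ))) hx≡μ ⟩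
    D x * (scale * (μ - μ))    ≡⟨ cong (λ z → D x * (scale * z)) (ℚ.+-inverseʳ μ) ⟩
    D x * (scale * 0ℚ)         ≡⟨ cong (D x *_) (ℚ.*-zeroʳ scale) ⟩
    D x * 0ℚ                   ≡⟨ ℚ.*-zeroʳ (D x) ⟩
    0ℚ                         ∎
    where open ≡-Reasoning

  shifted-≢0⇒≢0 : ∀ x → shifted x ≢ 0ℚ → D x ≢ 0ℚ
  shifted-≢0⇒≢0 x shifted≢0 Dx≡0 = shifted≢0 (p≡0⇒p*q≡0 _ Dx≡0)

  shifted-symmetricKUniform : SymmetricKUniform k D → Symmetric h → Balanced k (reweight D h) →
    (∀ x → D x ≢ 0ℚ → μ ℚ.≤ h x) → SymmetricKUniform k shifted
  shifted-symmetricKUniform {k} ((D≥0 , ΣD≡1) , D-sym , D-uniform) h-sym Dh-balanced μ≤h =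
    (shifted-nonneg D≥0 μ≤h , Σshifted≡1) ,
    (λ π x → cong₂ (λ d z → d * (scale * (z - μ))) (D-sym π x) (h-sym π x)) ,
    (λ T 0<∣T∣ ∣T∣≤k → begin
      expect shifted (chi T)
        ≡⟨ expect-shifted (chi T) ⟩
      scale * expect (reweight D h) (chi T) + expect D (chi T)
        ≡⟨ cong₂ (λ a b → scale * a + b) (Dh-balanced T ∣T∣≤k) (D-uniform T 0<∣T∣ ∣T∣≤k) ⟩
      scale * 0ℚ + 0ℚ
        ≡⟨ cong (_+ 0ℚ) (ℚ.*-zeroʳ scale) ⟩
      0ℚ ∎)
    where
    open ≡-Reasoning
    Σshifted≡1 : sumℚ (map shifted (allPoints n)) ≡ 1ℚ
    Σshifted≡1 = begin
      sumℚ (map shifted (allPoints n))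
        ≡⟨ sumℚ≡expect-chi-⊥ shifted ⟩
      expect shifted (chi Subset.⊥)
        ≡⟨ expect-shifted (chi Subset.⊥) ⟩
      scale * expect (reweight D h) (chi Subset.⊥) + expect D (chi Subset.⊥)
        ≡⟨ cong₂ (λ a b → scale * a + b) (Dh-balanced Subset.⊥ (∣⊥∣≤ n k))
                                         (sym (sumℚ≡expect-chi-⊥ D)) ⟩
      scale * 0ℚ + sumℚ (map D (allPoints n))
        ≡⟨ cong₂ _+_ (ℚ.*-zeroʳ scale) ΣD≡1 ⟩
      0ℚ + 1ℚ
        ≡⟨ ℚ.+-identityˡ 1ℚ ⟩
      1ℚ ∎

-- Removing one level at a time

HasSupportPointAt : Distribution n → ℤ → Set
HasSupportPointAt {n} D v = Any (λ x → D x ≢ 0ℚ × coordSum x ≡ v) (allPoints n)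

hasSupportPointAt? : ∀ (D : Distribution n) v → Dec (HasSupportPointAt D v)
hasSupportPointAt? {n} D v = Any.any? (λ x → ¬? (D x ℚ.≟ 0ℚ) ×-dec (coordSum x ℤ.≟ v)) (allPoints n)

_without_ : List ℤ → ℤ → List ℤ
L without v = filter (λ w → ¬? (w ℤ.≟ v)) L

FewerLevels : ℕ → (n : ℕ) → List ℤ → Set
FewerLevels k n L =
  ∃[ D′ ] ∃[ v ] v ∈ L × SymmetricKUniform {n} k D′ × SumSupportedOn D′ (ListSet (L without v))

caratheodory-step : ∀ {D : Distribution n} {L} → SymmetricKUniform k D → Unique L →
  SumSupportedOn D (ListSet L) → suc k < length L → All (HasSupportPointAt D) L → FewerLevels k n L
caratheodory-step {n} {k} {D} {L} D-good@((D≥0 , _) , D-sym , _) L! supp k+1<|L| points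
  with c , c⊥rows , c≢0 ← nontrivial-solution L L! (List.applyUpTo (momentRow D) (suc k))
                            (subst (_< length L) (sym (List.length-applyUpTo (momentRow D) (suc k))) k+1<|L|)
  with v₀ , v₀∈L , cv₀≢0 ← find c≢0
  with x₀ , _ , Dx₀≢0 , refl ← find (All.lookup points v₀∈L)
  = shifted , coordSum x* , supp x* Dx*≢0 ,
    shifted-symmetricKUniform D-good (∘coordSum-symmetric c) g-balanced μ≤h ,
    λ x shifted≢0 → ∈.∈-filter⁺ (λ w → ¬? (w ℤ.≟ coordSum x*))
                                (supp x (shifted-≢0⇒≢0 x shifted≢0))
                                (λ sx≡sx* → shifted≢0 (shifted-vanishes x (cong c sx≡sx*)))
  where
  h : Cube n → ℚ
  h = c ∘ coordSum
  g-balanced : Balanced k (reweight D h)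
  g-balanced = balanced-reweight D-sym L! supp c⊥rows
  x* : Cube n
  x* = argmin h x₀ (support D)
  Dx*≢0 : D x* ≢ 0ℚ
  Dx*≢0 = argmin-all h Dx₀≢0 (support-≢0 D)
  μ≤h : ∀ x → D x ≢ 0ℚ → h x* ℚ.≤ h x
  μ≤h x Dx≢0 = All.lookup (f[argmin]≤f[xs] x₀ (support D)) (∈-support Dx≢0)
  open Shift D h (lowerBound-negative D≥0 (Balanced⇒sum≡0 g-balanced) Dx₀≢0 cv₀≢0 μ≤h)

drop-level : ∀ {D : Distribution n} {L} → SymmetricKUniform k D → Unique L → SumSupportedOn D (ListSet L) →
  suc k < length L → FewerLevels k n L
drop-level {n} {k} {D} {L} D-good L! supp k+1<|L| with All.all? (hasSupportPointAt? D) L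
... | yes points = caratheodory-step D-good L! supp k+1<|L| points
... | no ¬points with v , v∈L , no-point ← find (All.¬All⇒Any¬ (hasSupportPointAt? D) L ¬points) =
  D , v , v∈L , D-good ,
  λ x Dx≢0 → ∈.∈-filter⁺ (λ w → ¬? (w ℤ.≟ v)) (supp x Dx≢0)
                         (λ sx≡v → no-point (lose (allPoints-complete x) (Dx≢0 , sx≡v)))

reduce : ∀ m {D : Distribution n} {S : ℤ → Set} {L} → length L ≤ m →
  SymmetricKUniform k D → Unique L → All S L → SumSupportedOn D (ListSet L) →
  Σ (Distribution n) λ D′ → Σ (List ℤ) λ L′ →
    IsDistribution D′ × Symmetric D′ × KUniform k D′ ×
    All S L′ × length L′ ≤ suc k × SumSupportedOn D′ (ListSet L′)
reduce {k = k} m {D} {L = L} |L|≤m D-good@(D-dist , D-sym , D-uniform) L! L⊆S supp with length L ≤? suc k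
... | yes |L|≤k+1 = D , L , D-dist , D-sym , D-uniform , L⊆S , |L|≤k+1 , supp
reduce zero |L|≤0 _ _ _ _ | no |L|≰k+1 = ⊥-elim (|L|≰k+1 (ℕ.≤-trans |L|≤0 z≤n))
reduce (suc m) {L = L} |L|≤1+m D-good L! L⊆S supp | no |L|≰k+1
  with D′ , v , v∈L , D′-good , supp′ ← drop-level D-good L! supp (ℕ.≰⇒> |L|≰k+1)
  = reduce m (ℕ.≤-pred (ℕ.≤-trans (List.filter-notAll keep L (lose v∈L λ v≢v → v≢v refl)) |L|≤1+m))
           D′-good (Unique.filter⁺ keep L!) (All.filter⁺ keep L⊆S) supp′
  where
  keep = λ w → ¬? (w ℤ.≟ v)

supportSums : Distribution n → List ℤ
supportSums D = List.deduplicate ℤ._≟_ (map coordSum (support D))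

supportSums-unique : ∀ (D : Distribution n) → Unique (supportSums D)
supportSums-unique D = Unique.deduplicate-! ℤ._≟_ (map coordSum (support D))

supportSums-complete : ∀ (D : Distribution n) → SumSupportedOn D (ListSet (supportSums D))
supportSums-complete D x Dx≢0 = ∈.∈-deduplicate⁺ ℤ._≟_ (∈.∈-map⁺ coordSum (∈-support Dx≢0))

supportSums-⊆ : ∀ {D : Distribution n} {S} → SumSupportedOn D S → All S (supportSums D)
supportSums-⊆ {n} {D} {S} supp = All.tabulate λ v∈sums →
  sum-of-support-point
    (∈.∈-map⁻ coordSum (∈.∈-deduplicate⁻ ℤ._≟_ (map coordSum (support D)) v∈sums))
  where
  sum-of-support-point : ∀ {v} → ∃[ x ] x ∈ support D × v ≡ coordSum x → S v
  sum-of-support-point (x , x∈supp , refl) = supp x (All.lookup (support-≢0 D) x∈supp)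

mainTheorem10 : (n k : ℕ) (S : ℤ → Set) (D : Distribution n) →
    IsDistribution D → Symmetric D → KUniform k D → SumSupportedOn D S →
    Σ (Distribution n) λ D' → Σ (List ℤ) λ S' →
      IsDistribution D' × Symmetric D' × KUniform k D' ×
      All S S' × length S' ≤ suc k × SumSupportedOn D' (ListSet S')
mainTheorem10 n k S D D-dist D-sym D-uniform supp =
  reduce (length (supportSums D)) ℕ.≤-refl (D-dist , D-sym , D-uniform)
         (supportSums-unique D) (supportSums-⊆ supp) (supportSums-complete D)
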